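{- Let $w$ be a word with an LZ77 factorisation, and suppose a pairing of $w$ satisfies (P1) no two consecutive positions are both unpaired; (P2) the first two letters of any factor are paired with each other, and the last two letters of any factor are paired with each other; (P3) the letters of each factor and of its definition are paired in the same way. Then procedure Replace runs in time $O(|w|)$ and returns a word $w'$ together with an LZ77 factorisation of $w'$, with $|w'|\le \frac{2|w|+1}{3}$, and the factorisation of $w'$ has the same number of factors as the factorisation of $w$. If $p$ fresh letters were introduced, then $w'$ has $p$ fewer free letters than $w$.
   Context: Words are indexed from $1$; $w[i\,..\,j]$ is the subword from position $i$ to $j$. An LZ77 factorisation of $w$ is a representation $w=f_1\cdots f_\ell$ where each $f_i$ is either a single letter (a free letter) or a factor: $f_i=w[j\,..\,j+|f_i|-1]$ for some $j\le |f_1\cdots f_{i-1}|$, and $w[j\,..\,j+|f_i|-1]$ is the definition of $f_i$. A pairing of $w$ assigns to every position a value $\mathrm{pair}[i]\in\{L,R,N\}$ (first of a pair, second of a pair, unpaired), such that $\mathrm{pair}[i]=L$ iff $\mathrm{pair}[i+1]=R$. Procedure Replace: scan $w$ left to right with pointer $i$ in $w$ and pointer $i'$ in the new word $w'$ (both start at $1$), recording $\mathrm{pos}[i]=i'$ for each position $i$ that is not second in a pair. If position $i$ starts a factor whose definition starts at $j$, the new factor in $w'$ starts at $i'$ with definition starting at $\mathrm{pos}[j]$, and its letters are copied one by one from $w'$ starting at position $\mathrm{pos}[j]$: each copied letter advances $i'$ by $1$ and advances $i$ by $2$ if $\mathrm{pair}[i]=L$ and by $1$ otherwise, until the end of the factor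 in $w$ is passed; the last written position of $w'$ is marked as the end of the new factor. If position $i$ is a free letter: if unpaired it is copied to $w'[i']$ as a free letter (advance $i,i'$ by $1$); if paired with $i+1$ then $w'[i']$ is set to a fresh letter (a new letter not used before; this introduces one fresh letter), which is a free letter of $w'$, and $i$ advances by $2$, $i'$ by $1$. -}

module Defs where

open import Data.Nat using (ℕ; zero; suc; _+_; _*_; _∸_; _≤_; _<_; _≡ᵇ_; _<ᵇ_; _⊔_)
open import Data.List using (List; []; _∷_; _++_; [_]; length; foldr)
open import Data.Maybe using (Maybe; just; nothing; fromMaybe)
open import Data.Bool using (Bool; true; false; if_then_else_)
open import Data.Product using (_×_; _,_)
open import Data.Unit using (⊤)
open import Relation.Nullary using (¬_)
open import Relation.Binary.PropositionalEquality using (_≡_; _≢_)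
open import Function.Bundles using (_⇔_)

-- Words: lists over the alphabet ℕ.  POSITIONS ARE 0-INDEXED here
-- (paper position i corresponds to index i ∸ 1).

Word : Set
Word = List ℕ

at : {A : Set} → List A → ℕ → Maybe A
at []       _       = nothing
at (x ∷ _)  zero    = just x
at (_ ∷ xs) (suc i) = at xs i

-- an element f_i of a factorisation: a free letter, or a factor given
-- by the (0-indexed) start position of its definition and its length
data Factor : Set where
  free : (a : ℕ) → Factor
  copy : (def len : ℕ) → Factor

flen : Factor → ℕ
flen (free _)   = 1
flen (copy _ l) = l

-- IsFactAt w s fs : the list fs is a factorisation of the suffix of w
-- starting at (0-indexed) position s, where s = |f_1 ⋯ f_{i-1}|.
IsFactAt : Word → ℕ → List Factor → Set
IsFactAt w s []                 = length w ≡ s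
IsFactAt w s (free a ∷ fs)      = at w s ≡ just a × IsFactAt w (suc s) fs
IsFactAt w s (copy j l ∷ fs)    =
  -- definition starts at (1-indexed) position ≤ |f_1⋯f_{i-1}|, i.e. j < s
  j < s × 1 ≤ l ×
  (∀ k → k < l → at w (s + k) ≡ at w (j + k)) ×
  IsFactAt w (s + l) fs

IsLZ77 : Word → List Factor → Set
IsLZ77 w fs = IsFactAt w 0 fs

#factors : List Factor → ℕ
#factors []               = 0
#factors (free _ ∷ fs)    = #factors fs
#factors (copy _ _ ∷ fs)  = suc (#factors fs)

#free : List Factor → ℕ
#free []               = 0
#free (free _ ∷ fs)    = suc (#free fs)
#free (copy _ _ ∷ fs)  = #free fs

data Tag : Set where
  L R N : Tag      -- first of a pair, second of a pair, unpaired

-- a pairing of w: a tag for every position, with pair[i] = L iff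
-- pair[i+1] = R (for every i, including i = -1 and i = |w|, where
-- pair is undefined, so pair[first] ≠ R and pair[last] ≠ L)
IsPairing : Word → List Tag → Set
IsPairing w p =
  length p ≡ length w ×
  at p 0 ≢ just R ×
  (∀ i → (at p i ≡ just L) ⇔ (at p (suc i) ≡ just R))

P1 : List Tag → Set
P1 p = ∀ i → ¬ (at p i ≡ just N × at p (suc i) ≡ just N)

P2At : List Tag → ℕ → List Factor → Set
P2At p s []               = ⊤
P2At p s (free _ ∷ fs)    = P2At p (suc s) fs
P2At p s (copy j l ∷ fs)  =
  (2 ≤ l × at p s ≡ just L × at p (s + l ∸ 2) ≡ just L) ×
  P2At p (s + l) fs

P3At : List Tag → ℕ → List Factor → Set
P3At p s []               = ⊤
P3At p s (free _ ∷ fs)    = P3At p (suc s) fs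
P3At p s (copy j l ∷ fs)  =
  (∀ k → k < l → at p (s + k) ≡ at p (j + k)) ×
  P3At p (s + l) fs

P2 : List Tag → List Factor → Set
P2 p fs = P2At p 0 fs

P3 : List Tag → List Factor → Set
P3 p fs = P3At p 0 fs

-- Procedure Replace, as an explicit state machine.
-- Cost model: one unit per iteration of the main scan and one unit
-- per letter copied inside a factor (each such step is O(1)).

elemAt : ℕ → List Factor → ℕ → Maybe Factor
elemAt s []       i = nothing
elemAt s (f ∷ fs) i = if s ≡ᵇ i then just f else elemAt (s + flen f) fs i

isL : Maybe Tag → Bool
isL (just L) = true
isL _        = false

maxL : Word → ℕ
maxL = foldr _⊔_ 0

record State : Set where
  constructor st
  field
    i      : ℕ
    w'     : Word         -- word built so far; i' = length w'
    pos    : ℕ → ℕ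
    out    : List Factor
    nfresh : ℕ
    steps  : ℕ
open State public

setPos : (ℕ → ℕ) → ℕ → ℕ → (ℕ → ℕ)
setPos f i v x = if x ≡ᵇ i then v else f x

-- copying loop for a factor of w ending before position e, whose new
-- definition starts at position src of w'; k letters copied so far
copyLoop : List Tag → (fuel e src k : ℕ) → State → State
copyLoop p zero     e src k s = s
copyLoop p (suc fl) e src k (st i u ps o nf t) =
  if i <ᵇ e
  then copyLoop p fl e src (suc k)
         (st (if isL (at p i) then suc (suc i) else suc i)
             (u ++ [ fromMaybe 0 (at u (src + k)) ])
             (setPos ps i (length u))
             o nf (suc t))
  else st i u ps o nf t

-- main scan; fresh letters are  base, base+1, …  with base > every letter of w
mainLoop : Word → List Factor → List Tag → (base fuel : ℕ) → State → State
mainLoop w fs p base zero s = s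
mainLoop w fs p base (suc fl) s@(st i u ps o nf t) =
  if i <ᵇ length w then mainLoop w fs p base fl (body (elemAt 0 fs i)) else s
  where
  body : Maybe Factor → State
  body (just (copy j l)) =
    let src = ps j
        s'  = copyLoop p l (i + l) src 0 (st i u ps o nf (suc t))
    in record s' { out = o ++ [ copy src (length (w' s') ∸ length u) ] }
  body _ =
    if isL (at p i)
    then st (suc (suc i)) (u ++ [ base + nf ]) (setPos ps i (length u))
            (o ++ [ free (base + nf) ]) (suc nf) (suc t)
    else st (suc i) (u ++ [ fromMaybe 0 (at w i) ]) (setPos ps i (length u))
            (o ++ [ free (fromMaybe 0 (at w i)) ]) nf (suc t)

replace : Word → List Factor → List Tag → State
replace w fs p =
  mainLoop w fs p (suc (maxL w)) (suc (length w)) (st 0 [] (λ _ → 0) [] 0 0)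

-- Replace is a single left-to-right scan, so everything follows from an
-- invariant of the scan relating the processed prefix w[0 .. i) to the
-- output built so far.  Every letter written to w' consumes an unpaired
-- position or a whole pair, and (P1) forbids two unpaired positions in a
-- row, so 3|w'| ≤ 2i + 1.  Because of (P2) a pair never crosses the
-- boundary of a factor, so copying a factor stops exactly at its end; and
-- because of (P2) and (P3) the definition of a factor starts at the first
-- position of a pair, for which pos is already recorded, so the new
-- definition lies inside the part of w' already written.  A pair of free
-- letters becomes one fresh free letter, and every iteration costs O(1)
-- while moving i forward.

module Submission where

open import Defs
open import Data.Bool using (true; false)
open import Data.List using (List; []; _∷_; _++_; [_]; length)
open import Data.List.Properties using (length-++)
open import Data.Maybe using (just; nothing; fromMaybe)
open import Data.Nat using (ℕ; zero; suc; _+_; _*_; _∸_; _≤_; _<_; _≡ᵇ_; _<ᵇ_; z≤n; s≤s)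
open import Data.Nat.Properties
open import Data.Nat.Solver using (module +-*-Solver)
open import Data.Product using (_×_; ∃; _,_; proj₁; proj₂)
open import Data.Sum using (_⊎_; inj₁; inj₂)
open import Function.Bundles using (Equivalence)
open import Relation.Nullary using (contradiction)
open import Relation.Nullary.Reflects using (Reflects; ofʸ; ofⁿ; fromEquivalence)
open import Relation.Binary.PropositionalEquality hiding ([_])

private
  variable
    A : Set

at-just⇒< : ∀ (xs : List A) n {y} → at xs n ≡ just y → n < length xs
at-just⇒< []       n       ()
at-just⇒< (x ∷ xs) zero    _  = s≤s z≤n
at-just⇒< (x ∷ xs) (suc n) eq = s≤s (at-just⇒< xs n eq)

<⇒at-just : ∀ (xs : List A) n → n < length xs → ∃ λ y → at xs n ≡ just y
<⇒at-just (x ∷ xs) zero    _         = x , refl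
<⇒at-just (x ∷ xs) (suc n) (s≤s n<) = <⇒at-just xs n n<

at-++ˡ : ∀ (u v : List A) n → n < length u → at (u ++ v) n ≡ at u n
at-++ˡ (x ∷ u) v zero    _         = refl
at-++ˡ (x ∷ u) v (suc n) (s≤s n<) = at-++ˡ u v n n<

at-∷ʳ : ∀ (u : List A) y → at (u ++ [ y ]) (length u) ≡ just y
at-∷ʳ []      y = refl
at-∷ʳ (x ∷ u) y = at-∷ʳ u y

length-∷ʳ : ∀ (u : List A) y → length (u ++ [ y ]) ≡ suc (length u)
length-∷ʳ u y = trans (length-++ u) (+-comm (length u) 1)

at-∷ʳ-copy : ∀ (u : List ℕ) m → m < length u →
  let v = u ++ [ fromMaybe 0 (at u m) ] in at v (length u) ≡ at v m
at-∷ʳ-copy u m m< with <⇒at-just u m m<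
... | y , eq rewrite eq = trans (at-∷ʳ u y) (trans (sym eq) (sym (at-++ˡ u [ y ] m m<)))

IsFactAt-start≤length : ∀ v s gs → IsFactAt v s gs → s ≤ length v
IsFactAt-start≤length v s []               eq                = ≤-reflexive (sym eq)
IsFactAt-start≤length v s (free a ∷ gs)    (_ , gs-fact)     =
  ≤-trans (n≤1+n s) (IsFactAt-start≤length v (suc s) gs gs-fact)
IsFactAt-start≤length v s (copy j l ∷ gs) (_ , _ , _ , gs-fact) =
  ≤-trans (m≤m+n s l) (IsFactAt-start≤length v (s + l) gs gs-fact)

IsFactAt-end : ∀ v s gs → IsFactAt v s gs → length v ≤ s → gs ≡ []
IsFactAt-end v s []                _                      _  = refl
IsFactAt-end v s (free a ∷ gs)     (eq , _)               ≤s = contradiction (at-just⇒< v s eq) (≤⇒≯ ≤s)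
IsFactAt-end v s (copy j l ∷ gs)   (_ , 1≤l , _ , gs-fact) ≤s =
  contradiction (<-≤-trans (m<m+n s 1≤l) (IsFactAt-start≤length v (s + l) gs gs-fact)) (≤⇒≯ ≤s)

IsFactAt-++ : ∀ u v s gs hs → IsFactAt u s gs → (∀ x → x < length u → at v x ≡ at u x) →
              IsFactAt v (length u) hs → IsFactAt v s (gs ++ hs)
IsFactAt-++ u v s []               hs eq                   prefix hs-fact =
  subst (λ z → IsFactAt v z hs) eq hs-fact
IsFactAt-++ u v s (free a ∷ gs)    hs (eq , gs-fact)       prefix hs-fact =
  trans (prefix s (at-just⇒< u s eq)) eq , IsFactAt-++ u v (suc s) gs hs gs-fact prefix hs-fact
IsFactAt-++ u v s (copy j l ∷ gs)  hs (j<s , 1≤l , same , gs-fact) prefix hs-fact =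
  j<s , 1≤l , same′ , IsFactAt-++ u v (s + l) gs hs gs-fact prefix hs-fact
  where
  same′ : ∀ k → k < l → at v (s + k) ≡ at v (j + k)
  same′ k k<l = trans (prefix (s + k) s+k<) (trans (same k k<l) (sym (prefix (j + k) j+k<)))
    where
    s+k< = <-≤-trans (+-monoʳ-< s k<l) (IsFactAt-start≤length u (s + l) gs gs-fact)
    j+k< = <-trans (+-monoˡ-< k j<s) s+k<

IsLZ77-∷ʳ-free : ∀ u o y → IsLZ77 u o → IsLZ77 (u ++ [ y ]) (o ++ [ free y ])
IsLZ77-∷ʳ-free u o y o-fact =
  IsFactAt-++ u (u ++ [ y ]) 0 o [ free y ] o-fact (λ x → at-++ˡ u [ y ] x) (at-∷ʳ u y , length-∷ʳ u y)

#factors-∷ʳ-free : ∀ gs a → #factors (gs ++ [ free a ]) ≡ #factors gs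
#factors-∷ʳ-free []               a = refl
#factors-∷ʳ-free (free _ ∷ gs)    a = #factors-∷ʳ-free gs a
#factors-∷ʳ-free (copy _ _ ∷ gs)  a = cong suc (#factors-∷ʳ-free gs a)

#factors-∷ʳ-copy : ∀ gs j l → #factors (gs ++ [ copy j l ]) ≡ suc (#factors gs)
#factors-∷ʳ-copy []               j l = refl
#factors-∷ʳ-copy (free _ ∷ gs)    j l = #factors-∷ʳ-copy gs j l
#factors-∷ʳ-copy (copy _ _ ∷ gs)  j l = cong suc (#factors-∷ʳ-copy gs j l)

#free-∷ʳ-free : ∀ gs a → #free (gs ++ [ free a ]) ≡ suc (#free gs)
#free-∷ʳ-free []               a = refl
#free-∷ʳ-free (free _ ∷ gs)    a = cong suc (#free-∷ʳ-free gs a)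
#free-∷ʳ-free (copy _ _ ∷ gs)  a = #free-∷ʳ-free gs a

#free-∷ʳ-copy : ∀ gs j l → #free (gs ++ [ copy j l ]) ≡ #free gs
#free-∷ʳ-copy []               j l = refl
#free-∷ʳ-copy (free _ ∷ gs)    j l = cong suc (#free-∷ʳ-copy gs j l)
#free-∷ʳ-copy (copy _ _ ∷ gs)  j l = #free-∷ʳ-copy gs j l

≡ᵇ-reflects-≡ : ∀ m n → Reflects (m ≡ n) (m ≡ᵇ n)
≡ᵇ-reflects-≡ m n = fromEquivalence (≡ᵇ⇒≡ m n) (≡⇒≡ᵇ m n)

setPos-≡ : ∀ f i v → setPos f i v i ≡ v
setPos-≡ f i v with i ≡ᵇ i | ≡ᵇ-reflects-≡ i i
... | true  | _       = refl
... | false | ofⁿ i≢i = contradiction refl i≢i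

setPos-≢ : ∀ f i v x → x ≢ i → setPos f i v x ≡ f x
setPos-≢ f i v x x≢i with x ≡ᵇ i | ≡ᵇ-reflects-≡ x i
... | true  | ofʸ x≡i = contradiction x≡i x≢i
... | false | _       = refl

elemAt-here : ∀ s f gs → elemAt s (f ∷ gs) s ≡ just f
elemAt-here s f gs with s ≡ᵇ s | ≡ᵇ-reflects-≡ s s
... | true  | _       = refl
... | false | ofⁿ s≢s = contradiction refl s≢s

elemAt-later : ∀ s f gs x → s < x → elemAt s (f ∷ gs) x ≡ elemAt (s + flen f) gs x
elemAt-later s f gs x s<x with s ≡ᵇ x | ≡ᵇ-reflects-≡ s x
... | true  | ofʸ s≡x = contradiction s≡x (<⇒≢ s<x)
... | false | _       = refl

-- gs is the part of fs that begins at position s, as far as the scan's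
-- lookups elemAt 0 fs x with x ≥ s can tell.
SuffixAt : List Factor → ℕ → List Factor → Set
SuffixAt fs s gs = ∀ x → s ≤ x → elemAt 0 fs x ≡ elemAt s gs x

SuffixAt-head : ∀ fs s f gs → SuffixAt fs s (f ∷ gs) → elemAt 0 fs s ≡ just f
SuffixAt-head fs s f gs suffix = trans (suffix s ≤-refl) (elemAt-here s f gs)

SuffixAt-tail : ∀ fs s f gs → 1 ≤ flen f → SuffixAt fs s (f ∷ gs) → SuffixAt fs (s + flen f) gs
SuffixAt-tail fs s f gs 1≤len suffix x ≤x =
  trans (suffix x (≤-trans (m≤m+n s (flen f)) ≤x)) (elemAt-later s f gs x (<-≤-trans (m<m+n s 1≤len) ≤x))

SuffixAt-free : ∀ fs s a gs → SuffixAt fs s (free a ∷ gs) → SuffixAt fs (suc s) gs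
SuffixAt-free fs s a gs suffix =
  subst (λ z → SuffixAt fs z gs) (+-comm s 1) (SuffixAt-tail fs s (free a) gs (s≤s z≤n) suffix)

m≡1+n⇒1+[m∸2]≡n : ∀ m {n} → 2 ≤ m → m ≡ suc n → suc (m ∸ 2) ≡ n
m≡1+n⇒1+[m∸2]≡n (suc zero)    (s≤s ()) _
m≡1+n⇒1+[m∸2]≡n (suc (suc m)) _        eq = suc-injective eq

time-step : ∀ t i → t ≤ 2 * i → suc t ≤ 2 * suc i
time-step t i t≤ rewrite *-suc 2 i = s≤s (m≤n⇒m≤1+n t≤)

time-pair-step : ∀ t i → t ≤ 2 * i → suc t ≤ 2 * suc (suc i)
time-pair-step t i t≤ = ≤-trans (time-step t i t≤) (*-monoʳ-≤ 2 (n≤1+n (suc i)))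

fuel-step : ∀ n i i′ fuel → n ≤ i + suc fuel → i < i′ → n ≤ i′ + fuel
fuel-step n i i′ fuel n≤ i< = ≤-trans n≤ (≤-trans (≤-reflexive (+-suc i fuel)) (+-monoˡ-≤ fuel i<))

[1+a]+[1+b]+c≡a+b+[2+c] : ∀ a b c → suc a + suc b + c ≡ a + b + suc (suc c)
[1+a]+[1+b]+c≡a+b+[2+c] = solve 3 (λ a b c → (con 1 :+ a) :+ (con 1 :+ b) :+ c := a :+ b :+ (con 2 :+ c)) refl
  where open +-*-Solver

module Replace (w : Word) (fs : List Factor) (p : List Tag) (base : ℕ)
               (pairing : IsPairing w p) (p1 : P1 p) where

  L⇒next-R : ∀ i → at p i ≡ just L → at p (suc i) ≡ just R
  L⇒next-R i = Equivalence.to (proj₂ (proj₂ pairing) i)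

  R⇒previous-L : ∀ i → at p (suc i) ≡ just R → at p i ≡ just L
  R⇒previous-L i = Equivalence.from (proj₂ (proj₂ pairing) i)

  L⇒after-pair-not-R : ∀ i → at p i ≡ just L → at p (suc (suc i)) ≢ just R
  L⇒after-pair-not-R i isL isR with trans (sym (L⇒next-R i isL)) (R⇒previous-L (suc i) isR)
  ... | ()

  N⇒next-not-R : ∀ i → at p i ≡ just N → at p (suc i) ≢ just R
  N⇒next-not-R i isN isR with trans (sym isN) (R⇒previous-L i isR)
  ... | ()

  <⇒tagged : ∀ i → i < length w → at p i ≢ nothing
  <⇒tagged i i< none with <⇒at-just p i (subst (i <_) (sym (proj₁ pairing)) i<)
  ... | _ , tagged with trans (sym none) tagged
  ... | ()

  L⇒not-R : ∀ x → at p x ≡ just L → at p x ≢ just R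
  L⇒not-R x isL isR with trans (sym isL) isR
  ... | ()

  EndsUnpaired : ℕ → Set
  EndsUnpaired i = ∃ λ k → i ≡ suc k × at p k ≡ just N

  -- The extra 1 in 3|w'| ≤ 2i + 1 is only allowed right after an unpaired
  -- position; by (P1) the next letter of w' then consumes a pair.
  LengthBound : ℕ → ℕ → Set
  LengthBound n i = 3 * n ≤ 2 * i ⊎ (3 * n ≤ suc (2 * i) × EndsUnpaired i)

  LengthBound-weaken : ∀ n i → LengthBound n i → 3 * n ≤ suc (2 * i)
  LengthBound-weaken n i (inj₁ bound)       = m≤n⇒m≤1+n bound
  LengthBound-weaken n i (inj₂ (bound , _)) = bound

  LengthBound-pair : ∀ n i → LengthBound n i → LengthBound (suc n) (suc (suc i))
  LengthBound-pair n i bound rewrite *-suc 3 n | *-suc 2 (suc i) | *-suc 2 i =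
    inj₁ (s≤s (s≤s (s≤s (LengthBound-weaken n i bound))))

  LengthBound-unpaired : ∀ n i → at p i ≡ just N → LengthBound n i → LengthBound (suc n) (suc i)
  LengthBound-unpaired n i isN (inj₁ bound) rewrite *-suc 3 n | *-suc 2 i =
    inj₂ (s≤s (s≤s (s≤s bound)) , i , refl , isN)
  LengthBound-unpaired n .(suc k) isN (inj₂ (_ , k , refl , isN′)) = contradiction (isN′ , isN) (p1 k)

  PosRecorded : (ℕ → ℕ) → ℕ → ℕ → Set
  PosRecorded ps n i = ∀ x → x < i → at p x ≢ just R → ps x < n

  PosRecorded-record : ∀ ps n i → PosRecorded ps n i → PosRecorded (setPos ps i n) (suc n) (suc i)
  PosRecorded-record ps n i recorded x x<1+i notR with m<1+n⇒m<n∨m≡n x<1+i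
  ... | inj₁ x<i  rewrite setPos-≢ ps i n x (<⇒≢ x<i) = m<n⇒m<1+n (recorded x x<i notR)
  ... | inj₂ refl rewrite setPos-≡ ps i n            = n<1+n n

  PosRecorded-skip : ∀ ps n i → at p i ≡ just R → PosRecorded ps n i → PosRecorded ps n (suc i)
  PosRecorded-skip ps n i isR recorded x x<1+i notR with m<1+n⇒m<n∨m≡n x<1+i
  ... | inj₁ x<i  = recorded x x<i notR
  ... | inj₂ refl = contradiction isR notR

  record Scanned (i n : ℕ) (ps : ℕ → ℕ) : Set where
    field
      not-R        : at p i ≢ just R
      length-bound : LengthBound n i
      pos-recorded : PosRecorded ps n i

  Scanned-pair : ∀ i (u : Word) ps y → at p i ≡ just L → Scanned i (length u) ps →
    Scanned (suc (suc i)) (length (u ++ [ y ])) (setPos ps i (length u))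
  Scanned-pair i u ps y isL scanned rewrite length-∷ʳ u y = record
    { not-R        = L⇒after-pair-not-R i isL
    ; length-bound = LengthBound-pair (length u) i length-bound
    ; pos-recorded = PosRecorded-skip _ _ (suc i) (L⇒next-R i isL)
                       (PosRecorded-record ps (length u) i pos-recorded)
    }
    where open Scanned scanned

  Scanned-unpaired : ∀ i (u : Word) ps y → at p i ≡ just N → Scanned i (length u) ps →
    Scanned (suc i) (length (u ++ [ y ])) (setPos ps i (length u))
  Scanned-unpaired i u ps y isN scanned rewrite length-∷ʳ u y = record
    { not-R        = N⇒next-not-R i isN
    ; length-bound = LengthBound-unpaired (length u) i isN length-bound
    ; pos-recorded = PosRecorded-record ps (length u) i pos-recorded
    }
    where open Scanned scanned

  record Invariant (rest : List Factor) (S : State) : Set where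
    field
      remaining : IsFactAt w (State.i S) rest
      p2        : P2At p (State.i S) rest
      p3        : P3At p (State.i S) rest
      suffix    : SuffixAt fs (State.i S) rest
      scanned   : Scanned (State.i S) (length (w' S)) (pos S)
      output    : IsLZ77 (w' S) (out S)
      time      : steps S ≤ 2 * State.i S
      factors   : #factors (out S) + #factors rest ≡ #factors fs
      frees     : #free (out S) + nfresh S + #free rest ≡ #free fs

  Invariant-initial : IsLZ77 w fs → P2 p fs → P3 p fs → Invariant fs (st 0 [] (λ _ → 0) [] 0 0)
  Invariant-initial lz q2 q3 = record
    { remaining = lz ; p2 = q2 ; p3 = q3 ; suffix = λ _ _ → refl
    ; scanned   = record { not-R = proj₁ (proj₂ pairing) ; length-bound = inj₁ z≤n ; pos-recorded = λ _ () }
    ; output    = refl ; time = z≤n ; factors = refl ; frees = refl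
    }

  Invariant-unpaired : ∀ a rest i u ps o nf t → at p i ≡ just N →
    Invariant (free a ∷ rest) (st i u ps o nf t) →
    let y = fromMaybe 0 (at w i) in
    Invariant rest (st (suc i) (u ++ [ y ]) (setPos ps i (length u)) (o ++ [ free y ]) nf (suc t))
  Invariant-unpaired a rest i u ps o nf t isN inv = record
    { remaining = proj₂ remaining
    ; p2        = p2
    ; p3        = p3
    ; suffix    = SuffixAt-free fs i a rest suffix
    ; scanned   = Scanned-unpaired i u ps y isN scanned
    ; output    = IsLZ77-∷ʳ-free u o y output
    ; time      = time-step t i time
    ; factors   = trans (cong (_+ #factors rest) (#factors-∷ʳ-free o y)) factors
    ; frees     = begin
        #free (o ++ [ free y ]) + nf + #free rest ≡⟨ cong (λ z → z + nf + #free rest) (#free-∷ʳ-free o y) ⟩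
        suc (#free o + nf + #free rest)         ≡⟨ sym (+-suc _ _) ⟩
        #free o + nf + suc (#free rest)         ≡⟨ frees ⟩
        #free fs                                ∎
    }
    where
    open Invariant inv
    open ≡-Reasoning
    y = fromMaybe 0 (at w i)

  -- The partner of a paired free letter cannot start a factor (a factor
  -- starts with the first position of a pair), so it is a free letter too.
  Invariant-pair : ∀ a rest i u ps o nf t → at p i ≡ just L →
    Invariant (free a ∷ rest) (st i u ps o nf t) →
    ∃ λ rest′ → Invariant rest′
      (st (suc (suc i)) (u ++ [ base + nf ]) (setPos ps i (length u)) (o ++ [ free (base + nf) ]) (suc nf) (suc t))
  Invariant-pair a [] i u ps o nf t isL inv =
    contradiction (subst (suc i <_) (proj₁ pairing) (at-just⇒< p (suc i) (L⇒next-R i isL)))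
                  (<-irrefl (sym (proj₂ (Invariant.remaining inv))))
  Invariant-pair a (copy j l ∷ rest) i u ps o nf t isL inv
    with trans (sym (L⇒next-R i isL)) (proj₁ (proj₂ (proj₁ (Invariant.p2 inv))))
  ... | ()
  Invariant-pair a (free b ∷ rest) i u ps o nf t isL inv = rest , record
    { remaining = proj₂ (proj₂ remaining)
    ; p2        = p2
    ; p3        = p3
    ; suffix    = SuffixAt-free fs (suc i) b rest (SuffixAt-free fs i a (free b ∷ rest) suffix)
    ; scanned   = Scanned-pair i u ps y isL scanned
    ; output    = IsLZ77-∷ʳ-free u o y output
    ; time      = time-pair-step t i time
    ; factors   = trans (cong (_+ #factors rest) (#factors-∷ʳ-free o y)) factors
    ; frees     = trans (cong (λ z → z + suc nf + #free rest) (#free-∷ʳ-free o y))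
                        (trans ([1+a]+[1+b]+c≡a+b+[2+c] (#free o) nf (#free rest)) frees)
    }
    where
    open Invariant inv
    y = base + nf

  module CopyFactor (s l src : ℕ) (u₀ : Word) (2≤l : 2 ≤ l) (ends-paired : at p (s + l ∸ 2) ≡ just L)
                    (s+l≤ : s + l ≤ length w) (src< : src < length u₀) where

    record CopyInvariant (k : ℕ) (S : State) : Set where
      field
        inside        : State.i S ≤ s + l
        scanned       : Scanned (State.i S) (length (w' S)) (pos S)
        copied-length : length (w' S) ≡ length u₀ + k
        prefix        : ∀ x → x < length u₀ → at (w' S) x ≡ at u₀ x
        copies        : ∀ k′ → k′ < k → at (w' S) (length u₀ + k′) ≡ at (w' S) (src + k′)
        time          : steps S ≤ suc (State.i S + s)
        consumed      : State.i S ≤ s + 2 * k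

    pair-inside : ∀ i → i < s + l → at p i ≡ just L → suc (suc i) ≤ s + l
    pair-inside i i< isL with m≤n⇒m<n∨m≡n i<
    ... | inj₁ 2+i≤ = 2+i≤
    ... | inj₂ 1+i≡ with trans (sym isL) (subst (λ z → at p z ≡ just R) last-pair (L⇒next-R _ ends-paired))
      where last-pair = m≡1+n⇒1+[m∸2]≡n (s + l) (≤-trans 2≤l (m≤n+m l s)) (sym 1+i≡)
    ... | ()

    copy-step : ∀ k i u ps o nf t i′ → CopyInvariant k (st i u ps o nf t) →
      i′ ≤ s + l → i < i′ → i′ ≤ suc (suc i) →
      let y = fromMaybe 0 (at u (src + k)) in
      Scanned i′ (length (u ++ [ y ])) (setPos ps i (length u)) →
      CopyInvariant (suc k) (st i′ (u ++ [ y ]) (setPos ps i (length u)) o nf (suc t))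
    copy-step k i u ps o nf t i′ inv i′≤ i< i′≤2+i scanned′ = record
      { inside        = i′≤
      ; scanned       = scanned′
      ; copied-length = trans (length-∷ʳ u y) (trans (cong suc copied-length) (sym (+-suc _ k)))
      ; prefix        = λ x x< → trans (at-++ˡ u [ y ] x (<-≤-trans x< u₀≤u)) (prefix x x<)
      ; copies        = copies′
      ; time          = ≤-trans (s≤s time) (s≤s (+-monoˡ-≤ s i<))
      ; consumed      = ≤-trans i′≤2+i (≤-trans (s≤s (s≤s consumed)) (≤-reflexive (sym two-more)))
      }
      where
      open CopyInvariant inv
      y = fromMaybe 0 (at u (src + k))
      u₀≤u : length u₀ ≤ length u
      u₀≤u = subst (length u₀ ≤_) (sym copied-length) (m≤m+n _ k)
      src+< : ∀ k′ → k′ ≤ k → src + k′ < length u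
      src+< k′ k′≤ = subst (src + k′ <_) (sym copied-length)
                       (<-≤-trans (+-monoˡ-< k′ src<) (+-monoʳ-≤ (length u₀) k′≤))
      two-more : s + 2 * suc k ≡ suc (suc (s + 2 * k))
      two-more = trans (cong (s +_) (*-suc 2 k))
                   (trans (+-suc s (suc (2 * k))) (cong suc (+-suc s (2 * k))))
      copies′ : ∀ k′ → k′ < suc k → at (u ++ [ y ]) (length u₀ + k′) ≡ at (u ++ [ y ]) (src + k′)
      copies′ k′ k′<1+k with m<1+n⇒m<n∨m≡n k′<1+k
      ... | inj₁ k′<k = trans (at-++ˡ u [ y ] _ u₀+k′<)
                          (trans (copies k′ k′<k) (sym (at-++ˡ u [ y ] _ (src+< k′ (<⇒≤ k′<k)))))
        where u₀+k′< = subst (length u₀ + k′ <_) (sym copied-length) (+-monoʳ-< (length u₀) k′<k)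
      ... | inj₂ refl rewrite sym copied-length = at-∷ʳ-copy u (src + k) (src+< k ≤-refl)

    copy-run : ∀ fuel k i u ps o nf t → CopyInvariant k (st i u ps o nf t) → s + l ≤ i + fuel →
      let S = copyLoop p fuel (s + l) src k (st i u ps o nf t) in
      nfresh S ≡ nf × State.i S ≡ s + l × ∃ λ k′ → CopyInvariant k′ S
    copy-run zero k i u ps o nf t inv ≤i+0 =
      refl , ≤-antisym (CopyInvariant.inside inv) (subst (s + l ≤_) (+-identityʳ i) ≤i+0) , k , inv
    copy-run (suc fuel) k i u ps o nf t inv ≤i+ with i <ᵇ s + l | <ᵇ-reflects-< i (s + l)
    ... | false | ofⁿ i≮ = refl , ≤-antisym (CopyInvariant.inside inv) (≮⇒≥ i≮) , k , inv
    ... | true  | ofʸ i< with at p i in tag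
    ...   | just L = copy-run fuel (suc k) (suc (suc i)) _ _ o nf (suc t)
                       (copy-step k i u ps o nf t _ inv (pair-inside i i< tag) (n≤1+n _) ≤-refl
                          (Scanned-pair i u ps _ tag (CopyInvariant.scanned inv)))
                       (fuel-step (s + l) i _ fuel ≤i+ (n≤1+n _))
    ...   | just N = copy-run fuel (suc k) (suc i) _ _ o nf (suc t)
                       (copy-step k i u ps o nf t _ inv i< ≤-refl (n≤1+n _)
                          (Scanned-unpaired i u ps _ tag (CopyInvariant.scanned inv)))
                       (fuel-step (s + l) i _ fuel ≤i+ ≤-refl)
    ...   | just R = contradiction tag (Scanned.not-R (CopyInvariant.scanned inv))
    ...   | nothing = contradiction tag (<⇒tagged i (<-≤-trans i< s+l≤))

    copy-finished : ∀ k S → CopyInvariant k S → State.i S ≡ s + l →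
      IsFactAt (w' S) (length u₀) [ copy src (length (w' S) ∸ length u₀) ] × steps S ≤ 2 * State.i S
    copy-finished zero S inv ends =
      contradiction (+-cancelˡ-≤ s l 0 (subst (_≤ s + 0) ends (CopyInvariant.consumed inv)))
                    (<⇒≱ (≤-trans (s≤s z≤n) 2≤l))
    copy-finished (suc k) S inv ends =
        subst (λ z → IsFactAt (w' S) (length u₀) [ copy src z ]) (sym length≡)
          (src< , s≤s z≤n , copies , copied-length)
      , (begin
          steps S               ≤⟨ time ⟩
          suc (State.i S + s)   ≡⟨ sym (+-suc (State.i S) s) ⟩
          State.i S + suc s     ≤⟨ +-monoʳ-≤ (State.i S) s<i ⟩
          State.i S + State.i S ≡⟨ cong (State.i S +_) (sym (+-identityʳ (State.i S))) ⟩
          2 * State.i S         ∎)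
      where
      open CopyInvariant inv
      open ≤-Reasoning
      length≡ : length (w' S) ∸ length u₀ ≡ suc k
      length≡ = trans (cong (_∸ length u₀) copied-length) (m+n∸m≡n (length u₀) (suc k))
      s<i : s < State.i S
      s<i = subst (s <_) (sym ends) (m<m+n s (≤-trans (s≤s z≤n) 2≤l))

  definition-starts-paired : ∀ i j l rest → P2At p i (copy j l ∷ rest) → P3At p i (copy j l ∷ rest) →
    at p j ≡ just L
  definition-starts-paired i j l rest ((2≤l , isL , _) , _) (same , _) =
    trans (sym (subst₂ (λ a b → at p a ≡ at p b) (+-identityʳ i) (+-identityʳ j) same-start)) isL
    where same-start = same 0 (≤-trans (s≤s z≤n) 2≤l)

  Invariant-copy : ∀ j l rest i u ps o nf t → Invariant (copy j l ∷ rest) (st i u ps o nf t) →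
    let S = copyLoop p l (i + l) (ps j) 0 (st i u ps o nf (suc t)) in
    Invariant rest (record S { out = o ++ [ copy (ps j) (length (w' S) ∸ length u) ] }) × i < State.i S
  Invariant-copy j l rest i u ps o nf t inv = record
      { remaining = subst (λ z → IsFactAt w z rest) (sym ends) rest-fact
      ; p2        = subst (λ z → P2At p z rest) (sym ends) (proj₂ p2)
      ; p3        = subst (λ z → P3At p z rest) (sym ends) (proj₂ p3)
      ; suffix    = subst (λ z → SuffixAt fs z rest) (sym ends) (SuffixAt-tail fs i (copy j l) rest 1≤l suffix)
      ; scanned   = CopyInvariant.scanned final
      ; output    = IsFactAt-++ u (w' S) 0 o _ output (CopyInvariant.prefix final) (proj₁ finished)
      ; time      = proj₂ finished
      ; factors   = trans (cong (_+ #factors rest) (#factors-∷ʳ-copy o _ _))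
                          (trans (sym (+-suc (#factors o) (#factors rest))) factors)
      ; frees     = trans (cong₂ (λ a b → a + b + #free rest) (#free-∷ʳ-copy o _ _) no-fresh) frees
      }
    , subst (i <_) (sym ends) (m<m+n i 1≤l)
    where
    open Invariant inv
    S = copyLoop p l (i + l) (ps j) 0 (st i u ps o nf (suc t))
    rest-fact = proj₂ (proj₂ (proj₂ remaining))
    2≤l = proj₁ (proj₁ p2)
    1≤l = ≤-trans (s≤s z≤n) 2≤l
    src< : ps j < length u
    src< = Scanned.pos-recorded scanned j (proj₁ remaining)
             (L⇒not-R j (definition-starts-paired i j l rest p2 p3))
    open CopyFactor i l (ps j) u 2≤l (proj₂ (proj₂ (proj₁ p2)))
                    (IsFactAt-start≤length w (i + l) rest rest-fact) src<
    start : CopyInvariant 0 (st i u ps o nf (suc t))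
    start = record
      { inside        = m≤m+n i l
      ; scanned       = scanned
      ; copied-length = sym (+-identityʳ _)
      ; prefix        = λ _ _ → refl
      ; copies        = λ _ ()
      ; time          = s≤s (subst (t ≤_) (cong (i +_) (+-identityʳ i)) time)
      ; consumed      = ≤-reflexive (sym (+-identityʳ i))
      }
    run = copy-run l 0 i u ps o nf (suc t) start ≤-refl
    no-fresh = proj₁ run
    ends = proj₁ (proj₂ run)
    final = proj₂ (proj₂ (proj₂ run))
    finished = copy-finished (proj₁ (proj₂ (proj₂ run))) S final ends

  Invariant-stopped : ∀ rest S → Invariant rest S → length w ≤ State.i S → Invariant [] S
  Invariant-stopped rest S inv ≤i with IsFactAt-end w (State.i S) rest (Invariant.remaining inv) ≤i
  ... | refl = inv

  main-run : ∀ fuel rest i u ps o nf t → Invariant rest (st i u ps o nf t) → length w ≤ i + fuel →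
    Invariant [] (mainLoop w fs p base fuel (st i u ps o nf t))
  main-run zero rest i u ps o nf t inv ≤i+0 =
    Invariant-stopped rest _ inv (subst (length w ≤_) (+-identityʳ i) ≤i+0)
  main-run (suc fuel) rest i u ps o nf t inv ≤i+ with i <ᵇ length w | <ᵇ-reflects-< i (length w)
  main-run (suc fuel) rest i u ps o nf t inv ≤i+ | false | ofⁿ i≮ = Invariant-stopped rest _ inv (≮⇒≥ i≮)
  main-run (suc fuel) [] i u ps o nf t inv ≤i+ | true | ofʸ i< =
    contradiction (sym (Invariant.remaining inv)) (<⇒≢ i<)
  main-run (suc fuel) (free a ∷ rest) i u ps o nf t inv ≤i+ | true | ofʸ i<
    rewrite SuffixAt-head fs i (free a) rest (Invariant.suffix inv) with at p i in tag
  ... | just L = let rest′ , inv′ = Invariant-pair a rest i u ps o nf t tag inv in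
                 main-run fuel rest′ _ _ _ _ _ _ inv′ (fuel-step (length w) i _ fuel ≤i+ (n≤1+n _))
  ... | just N = main-run fuel rest _ _ _ _ _ _ (Invariant-unpaired a rest i u ps o nf t tag inv)
                          (fuel-step (length w) i _ fuel ≤i+ ≤-refl)
  ... | just R = contradiction tag (Scanned.not-R (Invariant.scanned inv))
  ... | nothing = contradiction tag (<⇒tagged i i<)
  main-run (suc fuel) (copy j l ∷ rest) i u ps o nf t inv ≤i+ | true | ofʸ i<
    rewrite SuffixAt-head fs i (copy j l) rest (Invariant.suffix inv) =
      let inv′ , i<i′ = Invariant-copy j l rest i u ps o nf t inv in
      main-run fuel rest _ _ _ _ _ _ inv′ (fuel-step (length w) i _ fuel ≤i+ i<i′)

  replace-correct : IsLZ77 w fs → P2 p fs → P3 p fs →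
    let S = mainLoop w fs p base (suc (length w)) (st 0 [] (λ _ → 0) [] 0 0) in
    steps S ≤ 2 * length w + 2 ×
    IsLZ77 (w' S) (out S) ×
    3 * length (w' S) ≤ 2 * length w + 1 ×
    #factors (out S) ≡ #factors fs ×
    #free (out S) + nfresh S ≡ #free fs
  replace-correct lz q2 q3 =
      ≤-trans (subst (λ n → steps S ≤ 2 * n) (sym remaining) time) (m≤m+n _ 2)
    , output
    , subst (3 * length (w' S) ≤_) (trans (cong (λ n → suc (2 * n)) (sym remaining)) (+-comm 1 _))
        (LengthBound-weaken (length (w' S)) (State.i S) (Scanned.length-bound scanned))
    , trans (sym (+-identityʳ _)) factors
    , trans (sym (+-identityʳ _)) frees
    where
    S = mainLoop w fs p base (suc (length w)) (st 0 [] (λ _ → 0) [] 0 0)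
    open Invariant (main-run (suc (length w)) fs 0 [] (λ _ → 0) [] 0 0 (Invariant-initial lz q2 q3) (n≤1+n _))

lemma2 : ∃ λ (c : ℕ) →
    ∀ (w : Word) (fs : List Factor) (p : List Tag) →
      IsLZ77 w fs → IsPairing w p → P1 p → P2 p fs → P3 p fs →
      steps (replace w fs p) ≤ c * length w + c ×
      IsLZ77 (w' (replace w fs p)) (out (replace w fs p)) ×
      3 * length (w' (replace w fs p)) ≤ 2 * length w + 1 ×
      #factors (out (replace w fs p)) ≡ #factors fs ×
      #free (out (replace w fs p)) + nfresh (replace w fs p) ≡ #free fs
lemma2 = 2 , λ w fs p lz pairing p1 → Replace.replace-correct w fs p (suc (maxL w)) pairing p1 lz
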